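{- If a finite poset $P$ has a unique maximum element, then for every $n$, $Tr(n,P)=\sum_{i=0}^{x(P)}\binom{n}{i}$.
   Context: The sets $F_1,\dots,F_{|P|}$ form a copy of a poset $P$ if there is a bijection $i:P\to\{F_1,\dots,F_{|P|}\}$ such that $p<_P p'$ implies $i(p)\subsetneq i(p')$; a family is $P$-free if it contains no copy of $P$. For $X$ a set and $\mathcal F$ a family, $\mathcal F|_X=\{F\cap X:F\in\mathcal F\}$. A family $\mathcal F\subseteq 2^{[n]}$ is trace $P$-free if $\mathcal F|_L$ is $P$-free for every $L\subseteq[n]$, and $Tr(n,P)$ is the maximum size of a trace $P$-free family in $2^{[n]}$. Let $x(n,P)$ be the largest integer $x$ such that $\binom{[n]}{\le x}=\{F\subseteq[n]:|F|\le x\}$ is $P$-free; $x(n,P)$ is non-increasing in $n$, and $x(P)$ denotes its limit (so $x(n,P)=x(P)$ for all large $n$). -}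

module Defs where

open import Data.Nat using (ℕ; zero; suc; _+_; _<_; _≤_)
open import Data.Nat.Combinatorics using (_C_)
open import Data.Fin using (Fin)
open import Data.Fin.Subset using (Subset; _⊂_; _∩_; ∣_∣)
open import Data.List using (List; length)
open import Data.List.Membership.Propositional using (_∈_)
open import Data.List.Relation.Unary.Unique.Propositional using (Unique)
open import Data.Product using (Σ; ∃; _×_)
open import Relation.Binary.Structures using (IsPartialOrder)
open import Relation.Binary.PropositionalEquality using (_≡_; _≢_)
open import Relation.Nullary using (¬_)

record FinPoset : Set₁ where
  field
    size : ℕ
    _≤P_ : Fin size → Fin size → Set
    isPartialOrder : IsPartialOrder _≡_ _≤P_

  _<P_ : Fin size → Fin size → Set
  p <P q = p ≤P q × p ≢ q

open FinPoset public

HasMaximum : FinPoset → Set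
HasMaximum P = Σ (Fin (size P)) λ t → ∀ p → _≤P_ P p t

Family : ℕ → Set₁
Family n = Subset n → Set

record Copy (P : FinPoset) {n : ℕ} (𝒢 : Family n) : Set where
  field
    emb : Fin (size P) → Subset n
    inFamily : ∀ p → 𝒢 (emb p)
    injective : ∀ p q → emb p ≡ emb q → p ≡ q
    monotone : ∀ p q → _<P_ P p q → emb p ⊂ emb q

Free : (P : FinPoset) {n : ℕ} → Family n → Set
Free P 𝒢 = ¬ Copy P 𝒢

-- Trace of a family (given as a duplicate-free list) on L
trace : {n : ℕ} → List (Subset n) → Subset n → Family n
trace ℱ L S = ∃ λ F → F ∈ ℱ × S ≡ F ∩ L

TraceFree : (P : FinPoset) {n : ℕ} → List (Subset n) → Set
TraceFree P {n} ℱ = (L : Subset n) → Free P (trace ℱ L)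

IsTr : ℕ → FinPoset → ℕ → Set
IsTr n P t =
  (Σ (List (Subset n)) λ ℱ → Unique ℱ × TraceFree P ℱ × length ℱ ≡ t)
  × (∀ (ℱ : List (Subset n)) → Unique ℱ → TraceFree P ℱ → length ℱ ≤ t)

Ball : (n k : ℕ) → Family n
Ball n k S = ∣ S ∣ < k

-- x(n,P) = k - 1 (k : ℕ, so x = -1 is allowed, e.g. P a single point)
XnIsPred : ℕ → FinPoset → ℕ → Set
XnIsPred n P k = Free P (Ball n k) × ¬ Free P (Ball n (suc k))

XIsPred : FinPoset → ℕ → Set
XIsPred P k = Σ ℕ λ N → ∀ n → N ≤ n → XnIsPred n P k

sumBinom : ℕ → ℕ → ℕ
sumBinom n zero = 0
sumBinom n (suc k) = sumBinom n k + n C k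

module Submission where

-- Lower bound: the family of all sets of size < k is trace P-free, since each
-- of its traces again consists of sets of size < k, and the ball of radius
-- k - 1 is P-free in every dimension n (it is P-free in a large dimension n + N,
-- and smaller balls embed into larger ones).
--
-- Upper bound: by the Sauer–Shelah lemma (proved by the usual induction on n,
-- splitting a family into the "union" and "intersection" of its two slices),
-- a family with more than Σ_{i<k} (n choose i) members shatters some k-set L.
-- The ball of radius k in a large dimension contains a copy of P; because P has
-- a maximum, the whole copy lies below its top set A with |A| ≤ k, so
-- restricting to the coordinates of A and placing them inside L turns it into a
-- copy of P in the trace on L, which is all of 2^L.

open import Defs
open import Data.Nat using (ℕ; zero; suc; _+_; _<_; _≤_; z≤n; s≤s; _<?_)
open import Data.Nat.Properties
  using (≤-refl; ≤-reflexive; ≤-trans; ≤-<-trans; ≤-pred; <⇒≱; ≮⇒≥; m≤m+n; m≤n+m;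
         +-suc; +-identityʳ; +-monoˡ-≤; +-cancelˡ-<; +-commutativeSemigroup)
open import Data.Nat.Combinatorics using (_C_; nCk+nC[k+1]≡[n+1]C[k+1])
open import Algebra.Properties.CommutativeSemigroup +-commutativeSemigroup using (interchange; x∙yz≈y∙xz)
open import Data.Bool using (Bool; true; false)
import Data.Bool as Bool
open import Data.Vec using ([]; _∷_; here)
open import Data.Vec.Properties using (∷-injective; ≡-dec)
open import Data.List using (List; []; _∷_; length; _++_; map; filter)
open import Data.List.Properties using (length-++; length-map)
open import Data.List.Membership.Propositional using (_∈_)
open import Data.List.Membership.Propositional.Properties using (∈-map⁻; ∈-++⁻; ∈-filter⁻)
open import Data.List.Relation.Unary.Any using (here; there; any?)
open import Data.List.Relation.Unary.All using (All; []; _∷_)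
open import Data.List.Relation.Unary.AllPairs using ([]; _∷_)
open import Data.List.Relation.Unary.Unique.Propositional using (Unique)
import Data.List.Relation.Unary.Unique.Propositional.Properties as Unique
open import Data.Fin using (_≟_)
open import Data.Fin.Subset using (Subset; _⊆_; _⊂_; ∣_∣; ⊥; ⊤)
open import Data.Fin.Subset.Properties
  using (drop-∷-⊆; drop-∷-⊂; out⊆; in⊆in; s⊂s; out⊂; out⊂in; ⊆-antisym; ⊥⊆; ∩-zeroʳ;
         ∣⊥∣≡0; ∣⊤∣≡n; p⊆q⇒∣p∣≤∣q∣; p∩q⊆p)
open import Data.Product using (Σ; _×_; _,_; proj₁; proj₂)
open import Data.Sum using (_⊎_; inj₁; inj₂)
open import Relation.Binary.PropositionalEquality
  using (_≡_; _≢_; refl; sym; trans; cong; cong₂; subst; subst₂; module ≡-Reasoning)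
open import Relation.Nullary using (¬_; Dec; yes; no; ¬?; contradiction)

head-outside : ∀ {n} {b : Bool} {S T : Subset n} → (b ∷ S) ⊆ (false ∷ T) → b ≡ false
head-outside {b = false} _ = refl
head-outside {b = true} h with h here
... | ()

replace-tails-⊆ : ∀ {m n} {b c : Bool} {S T : Subset m} {S' T' : Subset n} →
  (b ∷ S) ⊆ (c ∷ T) → S' ⊆ T' → (b ∷ S') ⊆ (c ∷ T')
replace-tails-⊆ {b = false} _ h = out⊆ h
replace-tails-⊆ {b = true} {c = true} _ h = in⊆in h
replace-tails-⊆ {b = true} {c = false} h _ with h here
... | ()

replace-tails-⊂ : ∀ {m n} {b c : Bool} {S T : Subset m} {S' T' : Subset n} →
  (b ∷ S) ⊆ (c ∷ T) → S' ⊂ T' → (b ∷ S') ⊂ (c ∷ T')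
replace-tails-⊂ {b = false} _ h = out⊂ h
replace-tails-⊂ {b = true} {c = true} _ h = s⊂s h
replace-tails-⊂ {b = true} {c = false} h _ with h here
... | ()

⊂-uncons : ∀ {m} {b c : Bool} {S T : Subset m} →
  (b ∷ S) ⊂ (c ∷ T) → (S ⊂ T) ⊎ (b ≡ false × c ≡ true × S ⊆ T)
⊂-uncons {b = false} {c = false} h = inj₁ (drop-∷-⊂ h)
⊂-uncons {b = true} {c = true} h = inj₁ (drop-∷-⊂ h)
⊂-uncons {b = false} {c = true} h = inj₂ (refl , refl , drop-∷-⊆ (proj₁ h))
⊂-uncons {b = true} {c = false} h with proj₁ h here
... | ()

restrict : ∀ {N} (A : Subset N) → Subset N → Subset ∣ A ∣
restrict [] [] = []
restrict (true ∷ A) (b ∷ S) = b ∷ restrict A S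
restrict (false ∷ A) (_ ∷ S) = restrict A S

restrict-⊆ : ∀ {N} (A : Subset N) {S T : Subset N} → S ⊆ T → restrict A S ⊆ restrict A T
restrict-⊆ [] {[]} {[]} h = h
restrict-⊆ (true ∷ A) {_ ∷ _} {_ ∷ _} h = replace-tails-⊆ h (restrict-⊆ A (drop-∷-⊆ h))
restrict-⊆ (false ∷ A) {_ ∷ _} {_ ∷ _} h = restrict-⊆ A (drop-∷-⊆ h)

restrict-⊂ : ∀ {N} (A : Subset N) {S T : Subset N} → T ⊆ A → S ⊂ T → restrict A S ⊂ restrict A T
restrict-⊂ [] {[]} {[]} _ (_ , () , _)
restrict-⊂ (true ∷ A) {_ ∷ _} {_ ∷ _} T⊆A h with ⊂-uncons h
... | inj₁ h' = replace-tails-⊂ (proj₁ h) (restrict-⊂ A (drop-∷-⊆ T⊆A) h')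
... | inj₂ (refl , refl , h') = out⊂in (restrict-⊆ A h')
restrict-⊂ (false ∷ A) {_ ∷ _} {_ ∷ _} T⊆A h with ⊂-uncons h
... | inj₁ h' = restrict-⊂ A (drop-∷-⊆ T⊆A) h'
... | inj₂ (refl , refl , _) with head-outside T⊆A
... | ()

restrict-injective : ∀ {N} (A : Subset N) {S T : Subset N} → S ⊆ A → T ⊆ A →
  restrict A S ≡ restrict A T → S ≡ T
restrict-injective [] {[]} {[]} _ _ _ = refl
restrict-injective (true ∷ A) {_ ∷ _} {_ ∷ _} S⊆A T⊆A eq =
  cong₂ _∷_ (proj₁ (∷-injective eq))
    (restrict-injective A (drop-∷-⊆ S⊆A) (drop-∷-⊆ T⊆A) (proj₂ (∷-injective eq)))
restrict-injective (false ∷ A) {_ ∷ _} {_ ∷ _} S⊆A T⊆A eq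
  with head-outside S⊆A | head-outside T⊆A
... | refl | refl = cong (false ∷_) (restrict-injective A (drop-∷-⊆ S⊆A) (drop-∷-⊆ T⊆A) eq)

place : ∀ {n m} (L : Subset n) → Subset m → Subset n
place [] _ = []
place (false ∷ L) S = false ∷ place L S
place (true ∷ L) [] = false ∷ place L []
place (true ∷ L) (b ∷ S) = b ∷ place L S

place-⊆L : ∀ {n m} (L : Subset n) (S : Subset m) → place L S ⊆ L
place-⊆L [] _ = λ x → x
place-⊆L (false ∷ L) S = out⊆ (place-⊆L L S)
place-⊆L (true ∷ L) [] = out⊆ (place-⊆L L [])
place-⊆L (true ∷ L) (false ∷ S) = out⊆ (place-⊆L L S)
place-⊆L (true ∷ L) (true ∷ S) = in⊆in (place-⊆L L S)

place-⊆ : ∀ {n m} (L : Subset n) {S T : Subset m} → S ⊆ T → place L S ⊆ place L T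
place-⊆ [] _ = λ x → x
place-⊆ (false ∷ L) h = out⊆ (place-⊆ L h)
place-⊆ (true ∷ L) {[]} {[]} h = out⊆ (place-⊆ L h)
place-⊆ (true ∷ L) {_ ∷ _} {_ ∷ _} h = replace-tails-⊆ h (place-⊆ L (drop-∷-⊆ h))

place-⊂ : ∀ {n m} (L : Subset n) {S T : Subset m} → m ≤ ∣ L ∣ → S ⊂ T → place L S ⊂ place L T
place-⊂ [] {[]} {[]} _ (_ , () , _)
place-⊂ (false ∷ L) m≤L h = out⊂ (place-⊂ L m≤L h)
place-⊂ (true ∷ L) {[]} {[]} _ (_ , () , _)
place-⊂ (true ∷ L) {_ ∷ _} {_ ∷ _} (s≤s m≤L) h with ⊂-uncons h
... | inj₁ h' = replace-tails-⊂ (proj₁ h) (place-⊂ L m≤L h')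
... | inj₂ (refl , refl , h') = out⊂in (place-⊆ L h')

place-injective : ∀ {n m} (L : Subset n) {S T : Subset m} → m ≤ ∣ L ∣ →
  place L S ≡ place L T → S ≡ T
place-injective [] {[]} {[]} _ _ = refl
place-injective (false ∷ L) m≤L eq = place-injective L m≤L (proj₂ (∷-injective eq))
place-injective (true ∷ L) {[]} {[]} _ _ = refl
place-injective (true ∷ L) {_ ∷ _} {_ ∷ _} (s≤s m≤L) eq =
  cong₂ _∷_ (proj₁ (∷-injective eq)) (place-injective L m≤L (proj₂ (∷-injective eq)))

place-size : ∀ {n m} (L : Subset n) (S : Subset m) → ∣ place L S ∣ ≤ ∣ S ∣
place-size [] _ = z≤n
place-size (false ∷ L) S = place-size L S
place-size (true ∷ L) [] = place-size L []
place-size (true ∷ L) (false ∷ S) = place-size L S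
place-size (true ∷ L) (true ∷ S) = s≤s (place-size L S)

map-copy : ∀ {P m n} {𝒢 : Family m} {ℋ : Family n} (c : Copy P 𝒢) (φ : Subset m → Subset n) →
  (∀ p → ℋ (φ (Copy.emb c p))) →
  (∀ p q → φ (Copy.emb c p) ≡ φ (Copy.emb c q) → Copy.emb c p ≡ Copy.emb c q) →
  (∀ p q → Copy.emb c p ⊂ Copy.emb c q → φ (Copy.emb c p) ⊂ φ (Copy.emb c q)) →
  Copy P ℋ
map-copy c φ images injective-φ monotone-φ = record
  { emb = λ p → φ (emb p)
  ; inFamily = images
  ; injective = λ p q eq → injective p q (injective-φ p q eq)
  ; monotone = λ p q p<q → monotone-φ p q (monotone p q p<q)
  }
  where open Copy c

free-subfamily : ∀ {P n} {𝒢 ℋ : Family n} → (∀ S → 𝒢 S → ℋ S) → Free P ℋ → Free P 𝒢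
free-subfamily 𝒢⊆ℋ ℋ-free c = ℋ-free (map-copy c (λ S → S) (λ p → 𝒢⊆ℋ _ (Copy.inFamily c p))
  (λ _ _ eq → eq) (λ _ _ lt → lt))

below-top : ∀ {P n} {𝒢 : Family n} (top : HasMaximum P) (c : Copy P 𝒢) →
  ∀ p → Copy.emb c p ⊆ Copy.emb c (proj₁ top)
below-top (t , p≤t) c p with p ≟ t
... | yes refl = λ x → x
... | no p≢t = proj₁ (Copy.monotone c p t (p≤t p , p≢t))

-- The ball of radius k - 1 is P-free in dimension m whenever it is in a larger
-- dimension m' (x(n,P) is non-increasing): place [m] onto the first m points of [m'].
ball-free-downward : ∀ {P m m'} k → m ≤ m' → Free P (Ball m' k) → Free P (Ball m k)
ball-free-downward {m = m} {m'} k m≤m' free c = free (map-copy c (place ⊤[m'])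
  (λ p → ≤-<-trans (place-size ⊤[m'] (emb p)) (inFamily p))
  (λ _ _ → place-injective ⊤[m'] room) (λ _ _ → place-⊂ ⊤[m'] room))
  where
  open Copy c
  ⊤[m'] : Subset m'
  ⊤[m'] = ⊤
  room : m ≤ ∣ ⊤[m'] ∣
  room = subst (_ ≤_) (sym (∣⊤∣≡n m')) m≤m'

Shatters : ∀ {n} → List (Subset n) → Subset n → Set
Shatters ℱ L = ∀ S → S ⊆ L → trace ℱ L S

-- A copy of P among sets of size ≤ k, with P having a maximum, yields a copy in
-- the trace of any family shattering a set L of size ≥ k: restrict the copy to
-- the top set A (|A| ≤ k) and place it inside L.
shattered-copy : ∀ {P m n k} {ℱ : List (Subset n)} {L : Subset n} → HasMaximum P →
  Shatters ℱ L → k ≤ ∣ L ∣ → Copy P (Ball m (suc k)) → Copy P (trace ℱ L)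
shattered-copy {L = L} top shatters k≤L c = map-copy c (λ S → place L (restrict A S))
  (λ p → shatters _ (place-⊆L L _))
  (λ p q eq → restrict-injective A (below p) (below q) (place-injective L room eq))
  (λ p q p⊂q → place-⊂ L room (restrict-⊂ A (below q) p⊂q))
  where
  A = Copy.emb c (proj₁ top)
  below = below-top top c
  room : ∣ A ∣ ≤ ∣ L ∣
  room = ≤-trans (≤-pred (Copy.inFamily c (proj₁ top))) k≤L

sumBinom-pascal : ∀ n k → sumBinom (suc n) (suc k) ≡ sumBinom n k + sumBinom n (suc k)
sumBinom-pascal n zero = refl
sumBinom-pascal n (suc k) = begin
    sumBinom (suc n) (suc k) + suc n C suc k
  ≡⟨ cong₂ _+_ (sumBinom-pascal n k) (sym (nCk+nC[k+1]≡[n+1]C[k+1] n k)) ⟩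
    (sumBinom n k + sumBinom n (suc k)) + (n C k + n C suc k)
  ≡⟨ interchange (sumBinom n k) (sumBinom n (suc k)) (n C k) (n C suc k) ⟩
    sumBinom n (suc k) + sumBinom n (suc (suc k)) ∎
  where open ≡-Reasoning

sumBinom-zero : ∀ k → sumBinom 0 (suc k) ≡ 1
sumBinom-zero zero = refl
sumBinom-zero (suc k) = trans (+-identityʳ (sumBinom 0 (suc k))) (sumBinom-zero k)

+-<-cases : ∀ a b c d → a + b < c + d → a < c ⊎ b < d
+-<-cases a b c d lt with a <? c
... | yes a<c = inj₁ a<c
... | no a≮c = inj₂ (+-cancelˡ-< c b d (≤-<-trans (+-monoˡ-≤ b (≮⇒≥ a≮c)) lt))

unique-length-dim0 : (ℱ : List (Subset 0)) → Unique ℱ → length ℱ ≤ 1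
unique-length-dim0 [] _ = z≤n
unique-length-dim0 (_ ∷ []) _ = ≤-refl
unique-length-dim0 ([] ∷ [] ∷ _) ((distinct ∷ _) ∷ _) = contradiction refl distinct

shatters-empty : ∀ {n} (F : Subset n) (ℱ : List (Subset n)) → Shatters (F ∷ ℱ) ⊥
shatters-empty F ℱ S S⊆⊥ = F , here refl , trans (⊆-antisym S⊆⊥ ⊥⊆) (sym (∩-zeroʳ F))

slice : ∀ {n} → Bool → List (Subset (suc n)) → List (Subset n)
slice b [] = []
slice false ((false ∷ S) ∷ ℱ) = S ∷ slice false ℱ
slice false ((true ∷ _) ∷ ℱ) = slice false ℱ
slice true ((true ∷ S) ∷ ℱ) = S ∷ slice true ℱ
slice true ((false ∷ _) ∷ ℱ) = slice true ℱ

slice-∈ : ∀ {n} b (ℱ : List (Subset (suc n))) {S} → S ∈ slice b ℱ → (b ∷ S) ∈ ℱ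
slice-∈ false ((false ∷ _) ∷ ℱ) (here refl) = here refl
slice-∈ false ((false ∷ _) ∷ ℱ) (there S∈) = there (slice-∈ false ℱ S∈)
slice-∈ false ((true ∷ _) ∷ ℱ) S∈ = there (slice-∈ false ℱ S∈)
slice-∈ true ((true ∷ _) ∷ ℱ) (here refl) = here refl
slice-∈ true ((true ∷ _) ∷ ℱ) (there S∈) = there (slice-∈ true ℱ S∈)
slice-∈ true ((false ∷ _) ∷ ℱ) S∈ = there (slice-∈ true ℱ S∈)

slice-fresh : ∀ {n} b (ℱ : List (Subset (suc n))) {S} → All ((b ∷ S) ≢_) ℱ → All (S ≢_) (slice b ℱ)
slice-fresh b [] [] = []
slice-fresh false ((false ∷ _) ∷ ℱ) (≢F ∷ fresh) = (λ eq → ≢F (cong (false ∷_) eq)) ∷ slice-fresh false ℱ fresh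
slice-fresh false ((true ∷ _) ∷ ℱ) (_ ∷ fresh) = slice-fresh false ℱ fresh
slice-fresh true ((true ∷ _) ∷ ℱ) (≢F ∷ fresh) = (λ eq → ≢F (cong (true ∷_) eq)) ∷ slice-fresh true ℱ fresh
slice-fresh true ((false ∷ _) ∷ ℱ) (_ ∷ fresh) = slice-fresh true ℱ fresh

slice-unique : ∀ {n} b (ℱ : List (Subset (suc n))) → Unique ℱ → Unique (slice b ℱ)
slice-unique b [] [] = []
slice-unique false ((false ∷ _) ∷ ℱ) (fresh ∷ u) = slice-fresh false ℱ fresh ∷ slice-unique false ℱ u
slice-unique false ((true ∷ _) ∷ ℱ) (_ ∷ u) = slice-unique false ℱ u
slice-unique true ((true ∷ _) ∷ ℱ) (fresh ∷ u) = slice-fresh true ℱ fresh ∷ slice-unique true ℱ u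
slice-unique true ((false ∷ _) ∷ ℱ) (_ ∷ u) = slice-unique true ℱ u

slice-length : ∀ {n} (ℱ : List (Subset (suc n))) →
  length ℱ ≡ length (slice false ℱ) + length (slice true ℱ)
slice-length [] = refl
slice-length ((false ∷ _) ∷ ℱ) = cong suc (slice-length ℱ)
slice-length ((true ∷ _) ∷ ℱ) = trans (cong suc (slice-length ℱ)) (sym (+-suc _ _))

filter-length : ∀ {A : Set} {Q : A → Set} (Q? : ∀ x → Dec (Q x)) (xs : List A) →
  length xs ≡ length (filter Q? xs) + length (filter (λ x → ¬? (Q? x)) xs)
filter-length Q? [] = refl
filter-length Q? (x ∷ xs) with Q? x
... | yes _ = cong suc (filter-length Q? xs)
... | no _ = trans (cong suc (filter-length Q? xs)) (sym (+-suc _ _))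

ShattersSetOfSize : ∀ {n} → List (Subset n) → ℕ → Set
ShattersSetOfSize {n} ℱ k = Σ (Subset n) λ L → ∣ L ∣ ≡ k × Shatters ℱ L

SauerShelah : ℕ → ℕ → Set
SauerShelah n k = ∀ (ℱ : List (Subset n)) → Unique ℱ → sumBinom n k < length ℱ →
  ShattersSetOfSize ℱ k

-- The inductive step for ℱ ⊆ 2^[1+n]: the union and the intersection of the two
-- slices together have as many members as ℱ; a set shattered by the union
-- extends by "first point absent", one shattered by the intersection by
-- "first point present", to a set shattered by ℱ.
module SauerShelahStep {n : ℕ} (ℱ : List (Subset (suc n))) (u : Unique ℱ) where
  ℱ₀ ℱ₁ : List (Subset n)
  ℱ₀ = slice false ℱ
  ℱ₁ = slice true ℱ

  _∈ℱ₀? : ∀ S → Dec (S ∈ ℱ₀)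
  S ∈ℱ₀? = any? (λ T → ≡-dec Bool._≟_ S T) ℱ₀

  _∉ℱ₀? : ∀ S → Dec (¬ S ∈ ℱ₀)
  S ∉ℱ₀? = ¬? (S ∈ℱ₀?)

  union common : List (Subset n)
  union = ℱ₀ ++ filter _∉ℱ₀? ℱ₁
  common = filter _∈ℱ₀? ℱ₁

  union-unique : Unique union
  union-unique = Unique.++⁺ (slice-unique false ℱ u) (Unique.filter⁺ _∉ℱ₀? (slice-unique true ℱ u))
    (λ (S∈ℱ₀ , S∈rest) → proj₂ (∈-filter⁻ _∉ℱ₀? {xs = ℱ₁} S∈rest) S∈ℱ₀)

  common-unique : Unique common
  common-unique = Unique.filter⁺ _∈ℱ₀? (slice-unique true ℱ u)

  common-union-length : length common + length union ≡ length ℱ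
  common-union-length = begin
      length common + length union
    ≡⟨ cong (length common +_) (length-++ ℱ₀) ⟩
      length common + (length ℱ₀ + length (filter _∉ℱ₀? ℱ₁))
    ≡⟨ x∙yz≈y∙xz (length common) (length ℱ₀) _ ⟩
      length ℱ₀ + (length common + length (filter _∉ℱ₀? ℱ₁))
    ≡⟨ cong (length ℱ₀ +_) (sym (filter-length _∈ℱ₀? ℱ₁)) ⟩
      length ℱ₀ + length ℱ₁
    ≡⟨ sym (slice-length ℱ) ⟩
      length ℱ ∎
    where open ≡-Reasoning

  union-shatters : ∀ {L} → Shatters union L → Shatters ℱ (false ∷ L)
  union-shatters shatters (b ∷ S) S⊆L with head-outside S⊆L
  ... | refl with shatters S (drop-∷-⊆ S⊆L)
  ... | F , F∈union , S≡F∩L with ∈-++⁻ ℱ₀ F∈union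
  ... | inj₁ F∈ℱ₀ = false ∷ F , slice-∈ false ℱ F∈ℱ₀ , cong (false ∷_) S≡F∩L
  ... | inj₂ F∈rest =
    true ∷ F , slice-∈ true ℱ (proj₁ (∈-filter⁻ _∉ℱ₀? {xs = ℱ₁} F∈rest)) , cong (false ∷_) S≡F∩L

  common-shatters : ∀ {L} → Shatters common L → Shatters ℱ (true ∷ L)
  common-shatters shatters (b ∷ S) S⊆L with shatters S (drop-∷-⊆ S⊆L)
  ... | F , F∈common , S≡F∩L with ∈-filter⁻ _∈ℱ₀? {xs = ℱ₁} F∈common | b
  ... | _ , F∈ℱ₀ | false = false ∷ F , slice-∈ false ℱ F∈ℱ₀ , cong (false ∷_) S≡F∩L
  ... | F∈ℱ₁ , _ | true = true ∷ F , slice-∈ true ℱ F∈ℱ₁ , cong (true ∷_) S≡F∩L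

  -- By Pascal's rule one of the intersection (size k) or the union (size k + 1)
  -- exceeds the Sauer–Shelah bound in dimension n.
  step : ∀ {k} → SauerShelah n k → SauerShelah n (suc k) →
    sumBinom (suc n) (suc k) < length ℱ → ShattersSetOfSize ℱ (suc k)
  step {k} ih ih' big
    with +-<-cases (sumBinom n k) (sumBinom n (suc k)) (length common) (length union)
           (subst₂ _<_ (sumBinom-pascal n k) (sym common-union-length) big)
  ... | inj₁ big-common with ih common common-unique big-common
  ...   | L , ∣L∣≡k , shatters = true ∷ L , cong suc ∣L∣≡k , common-shatters shatters
  step {k} ih ih' big | inj₂ big-union with ih' union union-unique big-union
  ...   | L , ∣L∣≡1+k , shatters = false ∷ L , ∣L∣≡1+k , union-shatters shatters

sauer-shelah : ∀ n k → SauerShelah n k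
sauer-shelah n zero (F ∷ ℱ) _ _ = ⊥ , ∣⊥∣≡0 n , shatters-empty F ℱ
sauer-shelah zero (suc k) ℱ u big =
  contradiction (unique-length-dim0 ℱ u) (<⇒≱ (subst (_< length ℱ) (sumBinom-zero k) big))
sauer-shelah (suc n) (suc k) ℱ u =
  SauerShelahStep.step ℱ u (sauer-shelah n k) (sauer-shelah n (suc k))

smallSets : (n k : ℕ) → List (Subset n)
smallSets n zero = []
smallSets zero (suc k) = [] ∷ []
smallSets (suc n) (suc k) = map (true ∷_) (smallSets n k) ++ map (false ∷_) (smallSets n (suc k))

smallSets-length : ∀ n k → length (smallSets n k) ≡ sumBinom n k
smallSets-length n zero = refl
smallSets-length zero (suc k) = sym (sumBinom-zero k)
smallSets-length (suc n) (suc k) = begin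
    length (map (true ∷_) (smallSets n k) ++ map (false ∷_) (smallSets n (suc k)))
  ≡⟨ length-++ (map (true ∷_) (smallSets n k)) ⟩
    length (map (true ∷_) (smallSets n k)) + length (map (false ∷_) (smallSets n (suc k)))
  ≡⟨ cong₂ _+_ (length-map (true ∷_) (smallSets n k)) (length-map (false ∷_) (smallSets n (suc k))) ⟩
    length (smallSets n k) + length (smallSets n (suc k))
  ≡⟨ cong₂ _+_ (smallSets-length n k) (smallSets-length n (suc k)) ⟩
    sumBinom n k + sumBinom n (suc k)
  ≡⟨ sym (sumBinom-pascal n k) ⟩
    sumBinom (suc n) (suc k) ∎
  where open ≡-Reasoning

smallSets-small : ∀ n k {F} → F ∈ smallSets n k → ∣ F ∣ < k
smallSets-small zero (suc k) (here refl) = s≤s z≤n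
smallSets-small (suc n) (suc k) F∈ with ∈-++⁻ (map (true ∷_) (smallSets n k)) F∈
... | inj₁ F∈with with ∈-map⁻ (true ∷_) F∈with
...   | G , G∈ , refl = s≤s (smallSets-small n k G∈)
smallSets-small (suc n) (suc k) F∈ | inj₂ F∈without with ∈-map⁻ (false ∷_) F∈without
...   | G , G∈ , refl = smallSets-small n (suc k) G∈

smallSets-unique : ∀ n k → Unique (smallSets n k)
smallSets-unique n zero = []
smallSets-unique zero (suc k) = [] ∷ []
smallSets-unique (suc n) (suc k) =
  Unique.++⁺ (Unique.map⁺ (λ eq → proj₂ (∷-injective eq)) (smallSets-unique n k))
             (Unique.map⁺ (λ eq → proj₂ (∷-injective eq)) (smallSets-unique n (suc k)))
             disjoint
  where
  disjoint : ∀ {S} → ¬ (S ∈ map (true ∷_) (smallSets n k) × S ∈ map (false ∷_) (smallSets n (suc k)))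
  disjoint (S∈with , S∈without) with ∈-map⁻ (true ∷_) S∈with | ∈-map⁻ (false ∷_) S∈without
  ... | _ , _ , refl | _ , _ , ()

trace-smallSets : ∀ n k (L : Subset n) S → trace (smallSets n k) L S → Ball n k S
trace-smallSets n k L S (F , F∈ , refl) =
  ≤-<-trans (p⊆q⇒∣p∣≤∣q∣ (p∩q⊆p F L)) (smallSets-small n k F∈)

proposition2p7 : (P : FinPoset) → HasMaximum P → (k : ℕ) → XIsPred P k →
    (n : ℕ) → IsTr n P (sumBinom n k)
proposition2p7 P top k (N , x[n]≡k-1) n =
  (smallSets n k , smallSets-unique n k , lower , smallSets-length n k) , upper
  where
  ball-free : Free P (Ball n k)
  ball-free = ball-free-downward k (m≤m+n n N) (proj₁ (x[n]≡k-1 (n + N) (m≤n+m N n)))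

  lower : TraceFree P (smallSets n k)
  lower L = free-subfamily (trace-smallSets n k L) ball-free

  upper : ∀ (ℱ : List (Subset n)) → Unique ℱ → TraceFree P ℱ → length ℱ ≤ sumBinom n k
  upper ℱ u trace-free = ≮⇒≥ λ big →
    let (L , ∣L∣≡k , shatters) = sauer-shelah n k ℱ u big in
    proj₂ (x[n]≡k-1 N ≤-refl) λ c →
      trace-free L (shattered-copy top shatters (≤-reflexive (sym ∣L∣≡k)) c)
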